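{- For every $n\ge 6$ and every word $w$ of length $n$ over an alphabet $\Sigma$ with $|Alph(w)|=q$, $$SP(w)\le\sum_{i=1}^{n-3}q^{\lceil i/2\rceil}+\left\lceil\frac{n}{2}\right\rceil+2.$$
   Context: A scattered subword of $w$ is a (not necessarily contiguous) subsequence of $w$. A palindrome is a word equal to its reversal. $SP(w)$ is the number of distinct non-empty palindromes that are scattered subwords of $w$. $Alph(w)$ is the set of letters occurring in $w$. -}

module Defs where

open import Data.Nat using (ℕ; zero; suc; _+_; _^_; ⌈_/2⌉)
open import Data.List using (List; []; _∷_; reverse; filter; deduplicate; length; map; _++_)
open import Data.List.Properties using (≡-dec)
open import Relation.Binary.PropositionalEquality using (_≡_)
open import Relation.Binary.Definitions using (DecidableEquality)
open import Relation.Nullary using (Dec; yes; no; _×-dec_)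
open import Data.Product using (_×_)

module _ {a} {Σ : Set a} (_≟_ : DecidableEquality Σ) where

  subwords : List Σ → List (List Σ)
  subwords []       = [] ∷ []
  subwords (x ∷ xs) = let s = subwords xs in s ++ map (x ∷_) s

  NonEmpty : List Σ → Set a
  NonEmpty []      = Lift⊥
    where open import Data.Empty.Polymorphic using () renaming (⊥ to Lift⊥)
  NonEmpty (_ ∷ _) = Lift⊤
    where open import Data.Unit.Polymorphic using () renaming (⊤ to Lift⊤)

  nonEmpty? : (u : List Σ) → Dec (NonEmpty u)
  nonEmpty? []      = no (λ ())
  nonEmpty? (_ ∷ _) = yes _

  IsPalindrome : List Σ → Set a
  IsPalindrome u = u ≡ reverse u

  palindrome? : (u : List Σ) → Dec (IsPalindrome u)
  palindrome? u = ≡-dec _≟_ u (reverse u)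

  SP : List Σ → ℕ
  SP w = length (deduplicate (≡-dec _≟_)
           (filter (λ u → nonEmpty? u ×-dec palindrome? u) (subwords w)))

  Alph : List Σ → List Σ
  Alph w = deduplicate _≟_ w

sumFrom1 : ℕ → (ℕ → ℕ) → ℕ
sumFrom1 zero    f = 0
sumFrom1 (suc m) f = sumFrom1 m f + f (suc m)

-- Split the palindromic subwords of w (of length n) at length n − 3. The short ones are
-- palindromes over Alph w, and a palindrome of length i is determined by its first ⌈i/2⌉
-- letters. For the long ones, peel off the outer letters of w = x v y. If x ≠ y, a
-- palindromic subword cannot use both, so it is a subword of x v or of v y at least as long
-- as that word minus one, and each of these words has at most two such subwords. If x = y,
-- a long palindromic subword is either v itself or x u′ x with u′ a long palindromic
-- subword of v, so the count grows by one whenever the length grows by two.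
module Submission where

open import Defs
open import Data.Nat using (ℕ; zero; suc; _+_; _*_; _∸_; _^_; _≤_; _≤?_; ⌈_/2⌉; z≤n; s≤s)
open import Data.Nat.Properties
  using (module ≤-Reasoning; m+n≤o⇒m≤o∸n; ≤-refl; ≤-trans; +-suc; m≤n+m; m≤n⇒m<n∨m≡n; ≤-pred; ≤-antisym; ≤-reflexive; <⇒≱; +-monoˡ-≤; +-mono-≤; +-comm; +-assoc; *-identityʳ; ≰⇒>)
open import Data.Fin using (zero; suc)
open import Data.Fin.Properties using (injective⇒≤)
open import Data.List using (List; []; _∷_; [_]; _++_; length; reverse; map; lookup; cartesianProductWith)
open import Data.List.Properties using (length-++; length-++-≤ˡ; length-map; reverse-++; unfold-reverse; ∷-injective; ∷ʳ-injective; ≡-dec)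
open import Data.List.Reverse using (reverseView; []; _∶_∶ʳ_)
open import Data.List.Membership.Propositional using (_∈_)
open import Data.List.Membership.Propositional.Properties
  using (∈-lookup; ∈-map⁺; ∈-map⁻; ∈-++⁺ˡ; ∈-++⁺ʳ; ∈-++⁻; ∈-cartesianProductWith⁺; ∈-filter⁻; ∈-deduplicate⁺; ∈-deduplicate⁻)
open import Data.List.Relation.Unary.Any using (here; there)
open import Data.List.Relation.Unary.All as All using (All; _∷_)
open import Data.List.Relation.Unary.All.Properties using (++⁻ˡ)
open import Data.List.Relation.Unary.AllPairs using (_∷_)
open import Data.List.Relation.Unary.Unique.Propositional using (Unique)
open import Data.List.Relation.Binary.Sublist.Propositional using (_⊆_; []; _∷_; _∷ʳ_; ⊆-refl; ⊆-trans)
open import Data.List.Relation.Binary.Sublist.Propositional.Properties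
  using (length-mono-≤; to-≋; ∷ˡ⁻; ++⁺ʳ; Any-resp-⊆)
open import Data.List.Relation.Binary.Pointwise using (Pointwise-≡⇒≡)
open import Data.Product using (∃-syntax; _×_; _,_; proj₁; proj₂)
open import Data.Sum using (_⊎_; inj₁; inj₂)
open import Relation.Nullary using (yes; no; contradiction; _×-dec_)
open import Relation.Binary.PropositionalEquality using (_≡_; _≢_; refl; sym; trans; cong; cong₂; subst)
open import Relation.Binary.Definitions using (DecidableEquality)
open import Relation.Binary.PropositionalEquality.Properties using (setoid)
import Data.List.Membership.Setoid.Properties as SetoidMembership
import Data.List.Relation.Unary.Unique.DecPropositional.Properties as UniqueDec

length-cartesianProductWith : ∀ {a b c} {A : Set a} {B : Set b} {C : Set c} (f : A → B → C) xs ys →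
                              length (cartesianProductWith f xs ys) ≡ length xs * length ys
length-cartesianProductWith f []       ys = refl
length-cartesianProductWith f (x ∷ xs) ys =
  trans (length-++ (map (f x) ys)) (cong₂ _+_ (length-map (f x) ys) (length-cartesianProductWith f xs ys))

module _ {a} {A : Set a} where

  lookup-injective : ∀ {xs : List A} → Unique xs → ∀ {i j} → lookup xs i ≡ lookup xs j → i ≡ j
  lookup-injective {_ ∷ _} (_ ∷ _)   {zero}  {zero}  _  = refl
  lookup-injective {_ ∷ _} (x∉ ∷ _)  {zero}  {suc j} eq = contradiction eq (All.lookup x∉ (∈-lookup j))
  lookup-injective {_ ∷ _} (x∉ ∷ _)  {suc i} {zero}  eq = contradiction (sym eq) (All.lookup x∉ (∈-lookup i))
  lookup-injective {_ ∷ _} (_ ∷ xs!) {suc i} {suc j} eq = cong suc (lookup-injective xs! eq)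

  unique⇒length≤ : ∀ {xs ys : List A} → Unique xs → (∀ {z} → z ∈ xs → z ∈ ys) → length xs ≤ length ys
  unique⇒length≤ xs! xs⊆ys = injective⇒≤ λ {i} {j} eq →
    lookup-injective xs! (SetoidMembership.index-injective (setoid A) (xs⊆ys (∈-lookup i)) (xs⊆ys (∈-lookup j)) eq)

  -- Definitionally IsPalindrome _≟_, which does not actually depend on _≟_.
  Palindrome : List A → Set a
  Palindrome u = u ≡ reverse u

  wrap : A → List A → A → List A
  wrap x v y = x ∷ v ++ [ y ]

  length-wrap : ∀ x v y → length (wrap x v y) ≡ 2 + length v
  length-wrap x []      y = refl
  length-wrap x (c ∷ v) y = cong suc (length-wrap c v y)

  ≤-⌈wrap/2⌉+2 : ∀ {n} x v y → n ≤ suc ⌈ length v /2⌉ + 2 → n ≤ ⌈ length (wrap x v y) /2⌉ + 2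
  ≤-⌈wrap/2⌉+2 {n} x v y = subst (λ m → n ≤ ⌈ m /2⌉ + 2) (sym (length-wrap x v y))

  reverse-wrap : ∀ x v y → reverse (wrap x v y) ≡ wrap y (reverse v) x
  reverse-wrap x v y = trans (unfold-reverse x (v ++ [ y ])) (cong (_++ [ x ]) (reverse-++ v [ y ]))

  wrap-palindrome⁻ : ∀ {x v y} → Palindrome (wrap x v y) → x ≡ y × Palindrome v
  wrap-palindrome⁻ {x} {v} {y} pal with ∷-injective (trans pal (reverse-wrap x v y))
  ... | refl , v++x≡ = refl , proj₁ (∷ʳ-injective v (reverse v) v++x≡)

  ⊆-antisym-length : ∀ {u v : List A} → u ⊆ v → length v ≤ length u → u ≡ v
  ⊆-antisym-length u⊆v le = Pointwise-≡⇒≡ (to-≋ (≤-antisym (length-mono-≤ u⊆v) le) u⊆v)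

  ⊆-[x]⁻ : ∀ {u} {x : A} → u ⊆ [ x ] → u ≡ [] ⊎ u ≡ [ x ]
  ⊆-[x]⁻ (_ ∷ʳ [])   = inj₁ refl
  ⊆-[x]⁻ (refl ∷ []) = inj₂ refl

  ⊆-++[]⁻ : ∀ {u} v (y : A) → u ⊆ v ++ [ y ] → u ⊆ v ⊎ ∃[ u′ ] u ≡ u′ ++ [ y ] × u′ ⊆ v
  ⊆-++[]⁻ []      y (_ ∷ʳ [])   = inj₁ []
  ⊆-++[]⁻ []      y (refl ∷ []) = inj₂ ([] , refl , [])
  ⊆-++[]⁻ (c ∷ v) y (_ ∷ʳ p) with ⊆-++[]⁻ v y p
  ... | inj₁ q                = inj₁ (c ∷ʳ q)
  ... | inj₂ (u′ , refl , q)  = inj₂ (u′ , refl , c ∷ʳ q)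
  ⊆-++[]⁻ (c ∷ v) y (refl ∷ p) with ⊆-++[]⁻ v y p
  ... | inj₁ q                = inj₁ (refl ∷ q)
  ... | inj₂ (u′ , refl , q)  = inj₂ (c ∷ u′ , refl , refl ∷ q)

  ⊆-wrap⁻ : ∀ {u} x v (y : A) → u ⊆ wrap x v y →
            u ⊆ v ++ [ y ] ⊎ u ⊆ x ∷ v ⊎ ∃[ u′ ] u ≡ wrap x u′ y × u′ ⊆ v
  ⊆-wrap⁻ x v y (_ ∷ʳ p) = inj₁ p
  ⊆-wrap⁻ x v y (refl ∷ p) with ⊆-++[]⁻ v y p
  ... | inj₁ q               = inj₂ (inj₁ (refl ∷ q))
  ... | inj₂ (u′ , refl , q) = inj₂ (inj₂ (u′ , refl , q))

  palindrome-∷⁻ : ∀ {c} u → Palindrome (c ∷ u) → u ≡ [] ⊎ ∃[ x ] u ≡ x ++ [ c ] × Palindrome x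
  palindrome-∷⁻ u pal with reverseView u
  ... | []           = inj₁ refl
  ... | x ∶ _ ∶ʳ e with wrap-palindrome⁻ pal
  ...   | refl , px = inj₂ (x , refl , px)

  palindrome-⊆-wrap⁻ : ∀ {u} c v → Palindrome u → u ⊆ wrap c v c →
                       u ⊆ v ⊎ u ≡ [ c ] ⊎ ∃[ x ] u ≡ wrap c x c × x ⊆ v × Palindrome x
  palindrome-⊆-wrap⁻ c v pal p with ⊆-wrap⁻ c v c p
  ... | inj₁ q with ⊆-++[]⁻ v c q
  ...   | inj₁ r                   = inj₁ r
  ...   | inj₂ ([] , refl , _)     = inj₂ (inj₁ refl)
  ...   | inj₂ (d ∷ x , refl , r) with wrap-palindrome⁻ pal
  ...     | refl , px = inj₂ (inj₂ (x , refl , ∷ˡ⁻ r , px))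
  palindrome-⊆-wrap⁻ c v pal p | inj₂ (inj₁ (_ ∷ʳ r))   = inj₁ r
  palindrome-⊆-wrap⁻ c v pal p | inj₂ (inj₁ (refl ∷ r)) with palindrome-∷⁻ _ pal
  ... | inj₁ refl              = inj₂ (inj₁ refl)
  ... | inj₂ (x , refl , px)   = inj₂ (inj₂ (x , refl , ⊆-trans (++⁺ʳ [ c ] ⊆-refl) r , px))
  palindrome-⊆-wrap⁻ c v pal p | inj₂ (inj₂ (x , refl , r)) = inj₂ (inj₂ (x , refl , r , proj₂ (wrap-palindrome⁻ pal)))

  Covers : ℕ → List A → List (List A) → Set a
  Covers k w L = ∀ {u} → Palindrome u → u ⊆ w → length w ≤ k + length u → u ∈ L

  covers-self : ∀ w → Covers 0 w [ w ]
  covers-self w _ p le = here (⊆-antisym-length p le)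

  covers-[] : ∀ {k} → Covers k [] [ [] ]
  covers-[] _ [] _ = here refl

  covers-[x] : ∀ {k} x → Covers k [ x ] ([ x ] ∷ [ [] ])
  covers-[x] x _ p _ with ⊆-[x]⁻ p
  ... | inj₁ refl = there (here refl)
  ... | inj₂ refl = here refl

  covers-[x,y] : ∀ {k x y} → x ≢ y → Covers k (x ∷ [ y ]) ([ x ] ∷ [ y ] ∷ [ [] ])
  covers-[x,y] {x = x} {y} x≢y pal p _ with ⊆-wrap⁻ x [] y p
  ... | inj₁ q with ⊆-[x]⁻ q
  ...   | inj₁ refl = there (there (here refl))
  ...   | inj₂ refl = there (here refl)
  covers-[x,y] x≢y pal p _ | inj₂ (inj₁ q) with ⊆-[x]⁻ q
  ...   | inj₁ refl = there (there (here refl))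
  ...   | inj₂ refl = here refl
  covers-[x,y] x≢y pal p _ | inj₂ (inj₂ (_ , refl , _)) = contradiction (proj₁ (wrap-palindrome⁻ pal)) x≢y

  covers-wrap-≢ : ∀ {k x v y L₁ L₂} → x ≢ y → Covers k (x ∷ v) L₁ → Covers k (v ++ [ y ]) L₂ →
                  Covers (suc k) (wrap x v y) (L₁ ++ L₂)
  covers-wrap-≢ {k} {x} {v} {y} {L₁} x≢y cov₁ cov₂ {u} pal p le with ⊆-wrap⁻ x v y p
  ... | inj₁ q                   = ∈-++⁺ʳ L₁ (cov₂ pal q (≤-pred le))
  ... | inj₂ (inj₁ q)            = ∈-++⁺ˡ (cov₁ pal q (≤-pred (subst (_≤ suc k + length u) (length-wrap x v y) le)))
  ... | inj₂ (inj₂ (_ , refl , _)) = contradiction (proj₁ (wrap-palindrome⁻ pal)) x≢y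

  covers-wrap-≡ : ∀ {k x v E L} →
                  (∀ {u} → Palindrome u → u ⊆ v → 2 + length v ≤ k + length u → u ∈ E) →
                  (2 + length v ≤ k + 1 → [ x ] ∈ E) →
                  Covers k v L → Covers k (wrap x v x) (E ++ map (λ u → wrap x u x) L)
  covers-wrap-≡ {k} {x} {v} {E} inner single cov {u} pal p le
    with palindrome-⊆-wrap⁻ x v pal p | subst (_≤ k + length u) (length-wrap x v x) le
  ... | inj₁ q           | le′ = ∈-++⁺ˡ (inner pal q le′)
  ... | inj₂ (inj₁ refl) | le′ = ∈-++⁺ˡ (single le′)
  ... | inj₂ (inj₂ (u′ , refl , q , pal′)) | le′ =
    ∈-++⁺ʳ E (∈-map⁺ _ (cov pal′ q (≤-pred (≤-pred (subst (2 + length v ≤_) k+|u|≡2+k+|u′| le′)))))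
    where
    k+|u|≡2+k+|u′| : k + length (wrap x u′ x) ≡ 2 + (k + length u′)
    k+|u|≡2+k+|u′| = trans (cong (k +_) (length-wrap x u′ x)) (trans (+-suc k (suc (length u′))) (cong suc (+-suc k (length u′))))

  data Peel : List A → Set a where
    empty   : Peel []
    single  : ∀ x → Peel [ x ]
    wrapped : ∀ x {v} y → Peel v → Peel (wrap x v y)

  peel : ∀ w → Peel w
  peel w = peel-≤ (length w) w ≤-refl
    where
    peel-≤ : ∀ n w → length w ≤ n → Peel w
    peel-≤ _       []      _        = empty
    peel-≤ (suc n) (x ∷ w) (s≤s le) with reverseView w
    ... | []         = single x
    ... | v ∶ _ ∶ʳ y = wrapped x y (peel-≤ n v (≤-trans (length-++-≤ˡ v) le))

  module _ (_≟_ : DecidableEquality A) where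

    covers₁ : ∀ {w} → Peel w → ∃[ L ] length L ≤ 2 × Covers 1 w L
    covers₁ empty      = _ , s≤s z≤n , covers-[]
    covers₁ (single x) = _ , ≤-refl , covers-[x] x
    covers₁ (wrapped x {v} y p) with x ≟ y
    ... | no x≢y = _ , ≤-refl , covers-wrap-≢ x≢y (covers-self (x ∷ v)) (covers-self (v ++ [ y ]))
    covers₁ (wrapped x {[]} x p)    | yes refl =
      _ , ≤-refl , covers-wrap-≡ {E = [ [ x ] ]} (λ { _ [] (s≤s ()) }) (λ _ → here refl) covers-[]
    covers₁ (wrapped x {c ∷ v} x p) | yes refl with covers₁ p
    ... | L , |L|≤2 , cov =
      _ , ≤-trans (≤-reflexive (length-map _ L)) |L|≤2 ,
      covers-wrap-≡ {E = []} (λ _ q le → contradiction (length-mono-≤ q) (<⇒≱ (≤-pred le))) (λ { (s≤s (s≤s ())) }) cov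

    covers₂ : ∀ {w} → Peel w → ∃[ L ] length L ≤ ⌈ length w /2⌉ + 2 × Covers 2 w L
    covers₂ empty      = _ , s≤s z≤n , covers-[]
    covers₂ (single x) = _ , s≤s (s≤s z≤n) , covers-[x] x
    covers₂ (wrapped x {v} y p) with x ≟ y
    covers₂ (wrapped x {[]} y p) | no x≢y = _ , ≤-refl , covers-[x,y] x≢y
    covers₂ (wrapped x {c ∷ v} y p) | no x≢y
      with covers₁ (peel (x ∷ c ∷ v)) | covers₁ (peel (c ∷ v ++ [ y ]))
    ... | L₁ , |L₁|≤2 , cov₁ | L₂ , |L₂|≤2 , cov₂ =
      _ , ≤-⌈wrap/2⌉+2 x (c ∷ v) y |L₁++L₂|≤4 , covers-wrap-≢ x≢y cov₁ cov₂
      where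
      |L₁++L₂|≤4 : length (L₁ ++ L₂) ≤ suc ⌈ suc (length v) /2⌉ + 2
      |L₁++L₂|≤4 = ≤-trans (≤-reflexive (length-++ L₁)) (≤-trans (+-mono-≤ |L₁|≤2 |L₂|≤2) (s≤s (s≤s (m≤n+m 2 _))))
    covers₂ (wrapped x {[]} x p) | yes refl =
      _ , ≤-refl , covers-wrap-≡ {E = [] ∷ [ [ x ] ]} (λ { _ [] _ → here refl }) (λ _ → there (here refl)) covers-[]
    covers₂ (wrapped x {c ∷ []} x p) | yes refl =
      _ , ≤-refl , covers-wrap-≡ {E = [ c ] ∷ [ [ x ] ]} only-[c] (λ _ → there (here refl)) (covers-[x] c)
      where
      only-[c] : ∀ {u} → Palindrome u → u ⊆ [ c ] → 3 ≤ 2 + length u → u ∈ [ c ] ∷ [ [ x ] ]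
      only-[c] _ q le with ⊆-[x]⁻ q
      ... | inj₂ refl = here refl
      only-[c] _ q (s≤s (s≤s ())) | inj₁ refl
    covers₂ (wrapped x {v@(_ ∷ _ ∷ _)} x p) | yes refl with covers₂ p
    ... | L , |L|≤ , cov =
      _ , ≤-⌈wrap/2⌉+2 x v x (s≤s (≤-trans (≤-reflexive (length-map _ L)) |L|≤)) ,
      covers-wrap-≡ {E = [ v ]} (λ _ q le → here (⊆-antisym-length q (≤-pred (≤-pred le)))) (λ { (s≤s (s≤s (s≤s ()))) }) cov

  palindromesOfLength : List A → ℕ → List (List A)
  palindromesOfLength As zero          = [ [] ]
  palindromesOfLength As (suc zero)    = map [_] As
  palindromesOfLength As (suc (suc i)) = cartesianProductWith (λ c u → wrap c u c) As (palindromesOfLength As i)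

  length-palindromesOfLength : ∀ As i → length (palindromesOfLength As i) ≡ length As ^ ⌈ i /2⌉
  length-palindromesOfLength As zero          = refl
  length-palindromesOfLength As (suc zero)    = trans (length-map [_] As) (sym (*-identityʳ (length As)))
  length-palindromesOfLength As (suc (suc i)) =
    trans (length-cartesianProductWith _ As (palindromesOfLength As i)) (cong (length As *_) (length-palindromesOfLength As i))

  ∈-palindromesOfLength : ∀ {As u} → Peel u → Palindrome u → All (_∈ As) u → u ∈ palindromesOfLength As (length u)
  ∈-palindromesOfLength empty      _ _            = here refl
  ∈-palindromesOfLength (single x) _ (x∈ ∷ _)     = ∈-map⁺ [_] x∈
  ∈-palindromesOfLength {As} (wrapped x {v} y p) pal (x∈ ∷ v++y⊆) with wrap-palindrome⁻ pal
  ... | refl , pal′ =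
    subst (λ n → wrap x v x ∈ palindromesOfLength As n) (sym (length-wrap x v x))
      (∈-cartesianProductWith⁺ _ x∈ (∈-palindromesOfLength p pal′ (++⁻ˡ v v++y⊆)))

  palindromesUpTo : List A → ℕ → List (List A)
  palindromesUpTo As zero    = []
  palindromesUpTo As (suc m) = palindromesUpTo As m ++ palindromesOfLength As (suc m)

  length-palindromesUpTo : ∀ As m → length (palindromesUpTo As m) ≡ sumFrom1 m (λ i → length As ^ ⌈ i /2⌉)
  length-palindromesUpTo As zero    = refl
  length-palindromesUpTo As (suc m) =
    trans (length-++ (palindromesUpTo As m)) (cong₂ _+_ (length-palindromesUpTo As m) (length-palindromesOfLength As (suc m)))

  ∈-palindromesUpTo : ∀ {As u i} m → u ∈ palindromesOfLength As (suc i) → suc i ≤ m → u ∈ palindromesUpTo As m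
  ∈-palindromesUpTo {As} (suc m) u∈ le with m≤n⇒m<n∨m≡n le
  ... | inj₁ (s≤s lt) = ∈-++⁺ˡ (∈-palindromesUpTo m u∈ lt)
  ... | inj₂ refl     = ∈-++⁺ʳ (palindromesUpTo As m) u∈

module _ {a} {A : Set a} (_≟_ : DecidableEquality A) where

  ∈-subwords⁻ : ∀ w {u : List A} → u ∈ subwords _≟_ w → u ⊆ w
  ∈-subwords⁻ []      (here refl) = []
  ∈-subwords⁻ (x ∷ w) u∈ with ∈-++⁻ (subwords _≟_ w) u∈
  ... | inj₁ u∈′ = x ∷ʳ ∈-subwords⁻ w u∈′
  ... | inj₂ u∈′ with ∈-map⁻ (x ∷_) u∈′
  ...   | _ , u∈″ , refl = refl ∷ ∈-subwords⁻ w u∈″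

  SP≤length : ∀ w {L} → (∀ {u} → u ⊆ w → NonEmpty _≟_ u → Palindrome u → u ∈ L) → SP _≟_ w ≤ length L
  SP≤length w cover = unique⇒length≤ (UniqueDec.deduplicate-! (≡-dec _≟_) _) λ u∈ →
    let u∈s , nonEmpty , pal = ∈-filter⁻ (λ u → nonEmpty? _≟_ u ×-dec palindrome? _≟_ u) (∈-deduplicate⁻ (≡-dec _≟_) _ u∈) in
    cover (∈-subwords⁻ w u∈s) nonEmpty pal

  palindromic-subword-∈ : ∀ {w L u} → Covers 2 w L → u ⊆ w → NonEmpty _≟_ u → Palindrome u →
                          u ∈ L ++ palindromesUpTo (Alph _≟_ w) (length w ∸ 3)
  palindromic-subword-∈ {w} {L} {u@(_ ∷ _)} cov u⊆w _ pal with length w ≤? 2 + length u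
  ... | yes long = ∈-++⁺ˡ (cov pal u⊆w long)
  ... | no ¬long = ∈-++⁺ʳ L (∈-palindromesUpTo (length w ∸ 3) u∈ |u|≤|w|∸3)
    where
    u∈ : u ∈ palindromesOfLength (Alph _≟_ w) (length u)
    u∈ = ∈-palindromesOfLength (peel u) pal (All.tabulate λ c∈u → ∈-deduplicate⁺ _≟_ (Any-resp-⊆ u⊆w c∈u))
    |u|≤|w|∸3 : length u ≤ length w ∸ 3
    |u|≤|w|∸3 = m+n≤o⇒m≤o∸n (length u) (subst (_≤ length w) (+-comm 3 (length u)) (≰⇒> ¬long))

proposition4p17 : ∀ {a} {Σ : Set a} (_≟_ : DecidableEquality Σ)
    (n q : ℕ) → 6 ≤ n → (w : List Σ) → length w ≡ n →
    length (Alph _≟_ w) ≡ q →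
    SP _≟_ w ≤ sumFrom1 (n ∸ 3) (λ i → q ^ ⌈ i /2⌉) + ⌈ n /2⌉ + 2
proposition4p17 _≟_ _ _ _ w refl refl with covers₂ _≟_ (peel w)
... | L , |L|≤ , cov = begin
  SP _≟_ w                          ≤⟨ SP≤length _≟_ w (palindromic-subword-∈ _≟_ cov) ⟩
  length (L ++ short)               ≡⟨ length-++ L ⟩
  length L + length short           ≡⟨ cong (length L +_) (length-palindromesUpTo (Alph _≟_ w) (length w ∸ 3)) ⟩
  length L + S                      ≤⟨ +-monoˡ-≤ S |L|≤ ⟩
  ⌈ length w /2⌉ + 2 + S            ≡⟨ +-comm (⌈ length w /2⌉ + 2) S ⟩
  S + (⌈ length w /2⌉ + 2)          ≡⟨ +-assoc S _ 2 ⟨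
  S + ⌈ length w /2⌉ + 2            ∎
  where
  open ≤-Reasoning
  short : List (List _)
  short = palindromesUpTo (Alph _≟_ w) (length w ∸ 3)
  S : ℕ
  S = sumFrom1 (length w ∸ 3) (λ i → length (Alph _≟_ w) ^ ⌈ i /2⌉)
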